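{- For every integer $n \ge 3$, $D_n > 0$; that is, strictly more binary sequences of length $n$ have negative score than have positive score. Moreover, $D_{n+1} - D_n > 0$ for every integer $n \ge 2$.
   Context: For a binary sequence $x = (x_1,\dots,x_n) \in \{0,1\}^n$ define the score $$S(x) = \sum_{i=1}^{n-1} I[x_i = x_{i+1} = 1] - \sum_{i=1}^{n-1} I[x_i = 1,\ x_{i+1} = 0]$$ (Alice gets a point for each HH, Bob for each HT; $S$ is Alice's points minus Bob's). Let $$D_n = \#\{x \in \{0,1\}^n : S(x) < 0\} - \#\{x \in \{0,1\}^n : S(x) > 0\}.$$ -}

module Defs where

open import Data.Bool using (Bool; true; false)
open import Data.Nat using (ℕ; zero; suc)
open import Data.Integer using (ℤ; +_; _+_; _-_; _<_; _<?_)
open import Data.List using (List; []; _∷_; map; _++_; filter; length)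
open import Data.Vec using (Vec; []; _∷_)

allSeqs : (n : ℕ) → List (Vec Bool n)
allSeqs zero = [] ∷ []
allSeqs (suc n) = map (false ∷_) (allSeqs n) ++ map (true ∷_) (allSeqs n)

-- Contribution of the adjacent pair (x_i, x_{i+1}): +1 for HH (1,1), -1 for HT (1,0).
pairScore : Bool → Bool → ℤ
pairScore true  true  = + 1
pairScore true  false = Data.Integer.-[1+ 0 ]
pairScore false _     = + 0

score : {n : ℕ} → Vec Bool n → ℤ
score [] = + 0
score (x ∷ []) = + 0
score (x ∷ y ∷ xs) = pairScore x y + score (y ∷ xs)

countNeg : ℕ → ℕ
countNeg n = length (filter (λ x → score x <? + 0) (allSeqs n))

countPos : ℕ → ℕ
countPos n = length (filter (λ x → + 0 <? score x) (allSeqs n))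

D : ℕ → ℤ
D n = + countNeg n - + countPos n

-- Let end1 n s count the sequences of length n that end in 1 and have score s.
-- Appending a bit changes the score only after a final 1, by +1 (HH) or -1 (HT), and this
-- changes the sign of the score only when it was ±1; hence D (n+1) = 2 D n + end1 n 1 - end1 n (-1).
-- Removing the first bit gives
--   end1 (n+1) s = end1 n s + start1end1 n s,
--   start1end1 (n+1) s = end1 n (1 + s) + start1end1 n (-1 + s),
-- where start1end1 n s counts the sequences 1y with y of length n that end in 1 and have score s.
-- These recurrences force a reflection: start1end1 n (-k) is the k-fold iterated prefix sum of
-- m ↦ start1end1 m k (a disguised binomial symmetry). For k = 1 it reads start1end1 n (-1) = end1 n 1,
-- so end1 (n+1) (-1) = end1 n (-1) + end1 n 1, and induction gives D n = end1 n (-1) and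
-- D (n+1) - D n = end1 n 1. Both are counts, nondecreasing in n, and positive by the
-- witnesses 101 and 11.

{-# OPTIONS --safe #-}
module Submission where

open import Defs
open import Data.Nat using (ℕ; _≤_)
open import Data.Integer using (+_; _-_; _<_)
open import Data.Product using (_×_)

open import Data.Bool using (Bool; true; false; _∧_)
open import Data.Nat using (zero; suc; z≤n; s≤s; _≤′_; ≤′-refl; ≤′-step)
open import Data.Nat.Properties using (≤⇒≤′)
open import Data.Integer using (ℤ; _+_; -_; -[1+_]; 0ℤ; 1ℤ; -1ℤ; +≤+; +<+; _≟_; _<?_)
import Data.Nat as ℕ
import Data.Integer as ℤ
open import Data.Integer.Properties as ℤ
  using (+-identityˡ; +-identityʳ; +-comm; +-assoc; neg-distrib-+; pos-+; +-mono-≤; +-monoʳ-≤;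
         ≤-refl; ≤-trans; +-commutativeSemigroup)
open import Data.Integer.Tactic.RingSolver using (solve-∀)
open import Algebra.Properties.CommutativeSemigroup +-commutativeSemigroup using (interchange)
open import Data.List using (List; []; _∷_; map; _++_; filter; length)
open import Data.List.Properties using (length-++; filter-++)
open import Data.Vec using (Vec; []; _∷_; _∷ʳ_)
open import Data.Product using (_,_; proj₁; proj₂)
open import Function using (_∘_; mk⇔)
open import Relation.Nullary using (does)
open import Relation.Nullary.Decidable using (does-⇔)
open import Relation.Unary using (Pred; Decidable)
open import Relation.Binary.PropositionalEquality using (_≡_; refl; sym; trans; cong; cong₂; module ≡-Reasoning)

length-filter-map : ∀ {a b p} {A : Set a} {B : Set b} {P : Pred B p} (P? : Decidable P)
                    (f : A → B) (xs : List A) →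
                    length (filter P? (map f xs)) ≡ length (filter (P? ∘ f) xs)
length-filter-map P? f []       = refl
length-filter-map P? f (x ∷ xs) with does (P? (f x))
... | true  = cong suc (length-filter-map P? f xs)
... | false = length-filter-map P? f xs

does-+≟ : ∀ c t s → does (c + t ≟ s) ≡ does (t ≟ - c + s)
does-+≟ c t s = does-⇔ (mk⇔ (λ c+t≡s → trans (sym (cancel c t)) (cong (_+_ (- c)) c+t≡s))
                            (λ t≡-c+s → trans (cong (_+_ c) t≡-c+s) (uncancel c s)))
                       (c + t ≟ s) (t ≟ - c + s)
  where
  cancel : ∀ c t → - c + (c + t) ≡ t
  cancel = solve-∀
  uncancel : ∀ c s → c + (- c + s) ≡ s
  uncancel = solve-∀

𝟙 : Bool → ℤ
𝟙 false = 0ℤ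
𝟙 true  = 1ℤ

𝟙-nonneg : ∀ b → 0ℤ ℤ.≤ 𝟙 b
𝟙-nonneg false = +≤+ z≤n
𝟙-nonneg true  = +≤+ z≤n

sumSeqs : (n : ℕ) → (Vec Bool n → ℤ) → ℤ
sumSeqs zero    f = f []
sumSeqs (suc n) f = sumSeqs n (f ∘ (false ∷_)) + sumSeqs n (f ∘ (true ∷_))

length-filter-allSeqs : ∀ {p} n {P : Pred (Vec Bool n) p} (P? : Decidable P) →
                        + length (filter P? (allSeqs n)) ≡ sumSeqs n (𝟙 ∘ does ∘ P?)
length-filter-allSeqs zero    P? with does (P? [])
... | true  = refl
... | false = refl
length-filter-allSeqs (suc n) P? = begin
  + length (filter P? (map (false ∷_) seqs ++ map (true ∷_) seqs))
    ≡⟨ cong (+_ ∘ length) (filter-++ P? (map (false ∷_) seqs) _) ⟩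
  + length (filter P? (map (false ∷_) seqs) ++ filter P? (map (true ∷_) seqs))
    ≡⟨ cong +_ (length-++ (filter P? (map (false ∷_) seqs))) ⟩
  + (count false ℕ.+ count true) ≡⟨ pos-+ (count false) (count true) ⟩
  + count false + + count true   ≡⟨ cong₂ _+_ (count≡sum false) (count≡sum true) ⟩
  sumSeqs (suc n) (𝟙 ∘ does ∘ P?) ∎
  where
  open ≡-Reasoning
  seqs : List (Vec Bool n)
  seqs = allSeqs n
  count : Bool → ℕ
  count b = length (filter P? (map (b ∷_) seqs))
  count≡sum : ∀ b → + count b ≡ sumSeqs n (𝟙 ∘ does ∘ P? ∘ (b ∷_))
  count≡sum b = trans (cong +_ (length-filter-map P? (b ∷_) seqs)) (length-filter-allSeqs n (P? ∘ (b ∷_)))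

sumSeqs-cong : ∀ n {f g : Vec Bool n → ℤ} → (∀ x → f x ≡ g x) → sumSeqs n f ≡ sumSeqs n g
sumSeqs-cong zero    f≗g = f≗g []
sumSeqs-cong (suc n) f≗g =
  cong₂ _+_ (sumSeqs-cong n (f≗g ∘ (false ∷_))) (sumSeqs-cong n (f≗g ∘ (true ∷_)))

sumSeqs-+ : ∀ n (f g : Vec Bool n → ℤ) →
            sumSeqs n (λ x → f x + g x) ≡ sumSeqs n f + sumSeqs n g
sumSeqs-+ zero    f g = refl
sumSeqs-+ (suc n) f g = trans
  (cong₂ _+_ (sumSeqs-+ n (f ∘ (false ∷_)) (g ∘ (false ∷_))) (sumSeqs-+ n (f ∘ (true ∷_)) (g ∘ (true ∷_))))
  (interchange (sumSeqs n (f ∘ (false ∷_))) _ _ _)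

sumSeqs-neg : ∀ n (f : Vec Bool n → ℤ) → sumSeqs n (λ x → - f x) ≡ - sumSeqs n f
sumSeqs-neg zero    f = refl
sumSeqs-neg (suc n) f = trans
  (cong₂ _+_ (sumSeqs-neg n (f ∘ (false ∷_))) (sumSeqs-neg n (f ∘ (true ∷_))))
  (sym (neg-distrib-+ (sumSeqs n (f ∘ (false ∷_))) _))

sumSeqs-minus : ∀ n (f g : Vec Bool n → ℤ) →
                sumSeqs n (λ x → f x - g x) ≡ sumSeqs n f - sumSeqs n g
sumSeqs-minus n f g = trans (sumSeqs-+ n f (-_ ∘ g)) (cong (_+_ (sumSeqs n f)) (sumSeqs-neg n g))

sumSeqs-nonneg : ∀ n {f : Vec Bool n → ℤ} → (∀ x → 0ℤ ℤ.≤ f x) → 0ℤ ℤ.≤ sumSeqs n f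
sumSeqs-nonneg zero    f≥0 = f≥0 []
sumSeqs-nonneg (suc n) f≥0 =
  +-mono-≤ (sumSeqs-nonneg n (f≥0 ∘ (false ∷_))) (sumSeqs-nonneg n (f≥0 ∘ (true ∷_)))

sumSeqs-∷ʳ : ∀ n (f : Vec Bool (suc n) → ℤ) →
             sumSeqs (suc n) f ≡ sumSeqs n (λ x → f (x ∷ʳ false) + f (x ∷ʳ true))
sumSeqs-∷ʳ zero    f = refl
sumSeqs-∷ʳ (suc n) f = cong₂ _+_ (sumSeqs-∷ʳ n (f ∘ (false ∷_))) (sumSeqs-∷ʳ n (f ∘ (true ∷_)))

-- [] does not end in 1, consistent with appending to [] creating no pair (see score-∷ʳ).
endsInOne : ∀ {n} → Vec Bool n → Bool
endsInOne []           = false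
endsInOne (b ∷ [])     = b
endsInOne (_ ∷ c ∷ xs) = endsInOne (c ∷ xs)

endsWithScore : ∀ {n} → ℤ → Vec Bool n → Bool
endsWithScore s x = endsInOne x ∧ does (score x ≟ s)

score-∷ʳ : ∀ {n} (x : Vec Bool n) b → score (x ∷ʳ b) ≡ score x + pairScore (endsInOne x) b
score-∷ʳ []           b = refl
score-∷ʳ (a ∷ [])     b = trans (+-identityʳ (pairScore a b)) (sym (+-identityˡ (pairScore a b)))
score-∷ʳ (a ∷ c ∷ xs) b =
  trans (cong (_+_ (pairScore a c)) (score-∷ʳ (c ∷ xs) b)) (sym (+-assoc (pairScore a c) _ _))

endsWithScore-false∷ : ∀ {n} s (y : Vec Bool n) → endsWithScore s (false ∷ y) ≡ endsWithScore s y
endsWithScore-false∷ s []      = refl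
endsWithScore-false∷ s (b ∷ y) = cong (λ t → endsInOne (b ∷ y) ∧ does (t ≟ s)) (+-identityˡ (score (b ∷ y)))

endsWithScore-∷∷ : ∀ {n} s a b (y : Vec Bool n) →
                   endsWithScore s (a ∷ b ∷ y) ≡ endsWithScore (- pairScore a b + s) (b ∷ y)
endsWithScore-∷∷ s a b y = cong (endsInOne (b ∷ y) ∧_) (does-+≟ (pairScore a b) (score (b ∷ y)) s)

negSign : ℤ → ℤ
negSign t = 𝟙 (does (t <? 0ℤ)) - 𝟙 (does (0ℤ <? t))

D≡sum : ∀ n → D n ≡ sumSeqs n (negSign ∘ score)
D≡sum n = trans
  (cong₂ _-_ (length-filter-allSeqs n (λ x → score x <? 0ℤ)) (length-filter-allSeqs n (λ x → 0ℤ <? score x)))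
  (sym (sumSeqs-minus n (λ x → 𝟙 (does (score x <? 0ℤ))) (λ x → 𝟙 (does (0ℤ <? score x)))))

negSign-step : ∀ l t →
  negSign (t + pairScore l false) + negSign (t + pairScore l true)
    ≡ (negSign t + negSign t) + (𝟙 (l ∧ does (t ≟ 1ℤ)) - 𝟙 (l ∧ does (t ≟ -1ℤ)))
negSign-step false t = begin
  negSign (t + 0ℤ) + negSign (t + 0ℤ)  ≡⟨ cong (λ u → negSign u + negSign u) (+-identityʳ t) ⟩
  negSign t + negSign t                ≡⟨ sym (+-identityʳ _) ⟩
  (negSign t + negSign t) + 0ℤ         ∎
  where open ≡-Reasoning
negSign-step true (+ 0)            = refl
negSign-step true (+ 1)            = refl
negSign-step true (+ suc (suc k))  = refl
negSign-step true -[1+ 0 ]         = refl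
negSign-step true -[1+ suc k ]     = refl

end1 : ℕ → ℤ → ℤ
end1 n s = sumSeqs n (𝟙 ∘ endsWithScore s)

start1end1 : ℕ → ℤ → ℤ
start1end1 n s = sumSeqs n (λ y → 𝟙 (endsWithScore s (true ∷ y)))

D-suc : ∀ n → D (suc n) ≡ (D n + D n) + (end1 n 1ℤ - end1 n -1ℤ)
D-suc n = begin
  D (suc n)                                  ≡⟨ D≡sum (suc n) ⟩
  sumSeqs (suc n) (negSign ∘ score)          ≡⟨ sumSeqs-∷ʳ n (negSign ∘ score) ⟩
  sumSeqs n (λ x → negSign (score (x ∷ʳ false)) + negSign (score (x ∷ʳ true)))
    ≡⟨ sumSeqs-cong n step ⟩
  sumSeqs n (λ x → (w x + w x) + (𝟙 (endsWithScore 1ℤ x) - 𝟙 (endsWithScore -1ℤ x)))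
    ≡⟨ sumSeqs-+ n _ _ ⟩
  sumSeqs n (λ x → w x + w x) + sumSeqs n (λ x → 𝟙 (endsWithScore 1ℤ x) - 𝟙 (endsWithScore -1ℤ x))
    ≡⟨ cong₂ _+_ (sumSeqs-+ n w w) (sumSeqs-minus n _ _) ⟩
  (sumSeqs n w + sumSeqs n w) + (end1 n 1ℤ - end1 n -1ℤ)
    ≡⟨ cong (λ d → (d + d) + (end1 n 1ℤ - end1 n -1ℤ)) (sym (D≡sum n)) ⟩
  (D n + D n) + (end1 n 1ℤ - end1 n -1ℤ)     ∎
  where
  open ≡-Reasoning
  w : Vec Bool n → ℤ
  w = negSign ∘ score
  step : ∀ x → negSign (score (x ∷ʳ false)) + negSign (score (x ∷ʳ true))
                 ≡ (w x + w x) + (𝟙 (endsWithScore 1ℤ x) - 𝟙 (endsWithScore -1ℤ x))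
  step x = trans (cong₂ (λ u v → negSign u + negSign v) (score-∷ʳ x false) (score-∷ʳ x true))
                 (negSign-step (endsInOne x) (score x))

end1-suc : ∀ n s → end1 (suc n) s ≡ end1 n s + start1end1 n s
end1-suc n s = cong (_+ start1end1 n s) (sumSeqs-cong n (cong 𝟙 ∘ endsWithScore-false∷ s))

start1end1-suc : ∀ n s → start1end1 (suc n) s ≡ end1 n (1ℤ + s) + start1end1 n (-1ℤ + s)
start1end1-suc n s = cong₂ _+_
  (sumSeqs-cong n (λ y → cong 𝟙 (trans (endsWithScore-∷∷ s true false y) (endsWithScore-false∷ (1ℤ + s) y))))
  (sumSeqs-cong n (λ y → cong 𝟙 (endsWithScore-∷∷ s true true y)))

iteratedPrefixSum : ℕ → (ℕ → ℤ) → ℕ → ℤ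
iteratedPrefixSum zero    a n       = a n
iteratedPrefixSum (suc j) a zero    = 0ℤ
iteratedPrefixSum (suc j) a (suc n) = iteratedPrefixSum (suc j) a n + iteratedPrefixSum j a n

iteratedPrefixSum-zero : ∀ j {a : ℕ → ℤ} → a 0 ≡ 0ℤ → iteratedPrefixSum j a 0 ≡ 0ℤ
iteratedPrefixSum-zero zero    a0≡0 = a0≡0
iteratedPrefixSum-zero (suc j) a0≡0 = refl

end1≡prefixSum : ∀ n s → end1 n s ≡ iteratedPrefixSum 1 (λ m → start1end1 m s) n
end1≡prefixSum zero    s = refl
end1≡prefixSum (suc n) s = trans (end1-suc n s) (cong (_+ start1end1 n s) (end1≡prefixSum n s))

positiveSums : ℕ → ℕ → ℕ → ℤ
positiveSums j k = iteratedPrefixSum j (λ m → start1end1 m (+ k))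

positiveSums-pascal : ∀ j n k →
  positiveSums j (suc k) (suc n) ≡ positiveSums (suc j) (suc (suc k)) n + positiveSums j k n
positiveSums-pascal zero n k =
  trans (start1end1-suc n (+ suc k)) (cong (_+ start1end1 n (+ k)) (end1≡prefixSum n (+ suc (suc k))))
positiveSums-pascal (suc j) zero k =
  trans (+-identityˡ _) (iteratedPrefixSum-zero j refl)
positiveSums-pascal (suc j) (suc n) k =
  trans (cong₂ _+_ (positiveSums-pascal (suc j) n k) (positiveSums-pascal j n k))
        (interchange (positiveSums (suc (suc j)) (suc (suc k)) n) _ _ _)

1-[1+k]≡-k : ∀ k → 1ℤ + -[1+ k ] ≡ - + k
1-[1+k]≡-k zero    = refl
1-[1+k]≡-k (suc k) = refl

reflection : ∀ n k → start1end1 n (- + k) ≡ positiveSums k k n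
                   × end1 n (- + k) ≡ positiveSums (suc k) k n
reflection zero    zero    = refl , refl
reflection zero    (suc k) = refl , refl
reflection (suc n) k       = start1end1-reflection k , end1-reflection
  where
  start1end1-reflection : ∀ j → start1end1 (suc n) (- + j) ≡ positiveSums j j (suc n)
  start1end1-reflection zero    = refl
  start1end1-reflection (suc j) = begin
    start1end1 (suc n) -[1+ j ]
      ≡⟨ start1end1-suc n -[1+ j ] ⟩
    end1 n (1ℤ + -[1+ j ]) + start1end1 n -[1+ suc j ]
      ≡⟨ cong₂ _+_ (trans (cong (end1 n) (1-[1+k]≡-k j)) (proj₂ (reflection n j)))
                   (proj₁ (reflection n (suc (suc j)))) ⟩
    positiveSums (suc j) j n + positiveSums (suc (suc j)) (suc (suc j)) n
      ≡⟨ +-comm (positiveSums (suc j) j n) _ ⟩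
    positiveSums (suc (suc j)) (suc (suc j)) n + positiveSums (suc j) j n
      ≡⟨ sym (positiveSums-pascal (suc j) n j) ⟩
    positiveSums (suc j) (suc j) (suc n) ∎
    where open ≡-Reasoning
  end1-reflection : end1 (suc n) (- + k) ≡ positiveSums (suc k) k (suc n)
  end1-reflection = trans (end1-suc n (- + k))
                          (cong₂ _+_ (proj₂ (reflection n k)) (proj₁ (reflection n k)))

start1end1-neg1 : ∀ n → start1end1 n -1ℤ ≡ end1 n 1ℤ
start1end1-neg1 n = trans (proj₁ (reflection n 1)) (sym (end1≡prefixSum n 1ℤ))

end1-suc-neg1 : ∀ n → end1 (suc n) -1ℤ ≡ end1 n -1ℤ + end1 n 1ℤ
end1-suc-neg1 n = trans (end1-suc n -1ℤ) (cong (_+_ (end1 n -1ℤ)) (start1end1-neg1 n))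

D≡end1 : ∀ n → D n ≡ end1 n -1ℤ
D≡end1 zero    = refl
D≡end1 (suc n) = begin
  D (suc n)                                                ≡⟨ D-suc n ⟩
  (D n + D n) + (end1 n 1ℤ - end1 n -1ℤ)                   ≡⟨ cong (λ d → (d + d) + (end1 n 1ℤ - end1 n -1ℤ)) (D≡end1 n) ⟩
  (end1 n -1ℤ + end1 n -1ℤ) + (end1 n 1ℤ - end1 n -1ℤ)     ≡⟨ telescope (end1 n -1ℤ) (end1 n 1ℤ) ⟩
  end1 n -1ℤ + end1 n 1ℤ                                   ≡⟨ sym (end1-suc-neg1 n) ⟩
  end1 (suc n) -1ℤ                                         ∎
  where
  open ≡-Reasoning
  telescope : ∀ a b → (a + a) + (b - a) ≡ a + b
  telescope = solve-∀

D-suc-minus-D : ∀ n → D (suc n) - D n ≡ end1 n 1ℤ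
D-suc-minus-D n = begin
  D (suc n) - D n                            ≡⟨ cong₂ _-_ (D≡end1 (suc n)) (D≡end1 n) ⟩
  end1 (suc n) -1ℤ - end1 n -1ℤ              ≡⟨ cong (_- end1 n -1ℤ) (end1-suc-neg1 n) ⟩
  (end1 n -1ℤ + end1 n 1ℤ) - end1 n -1ℤ      ≡⟨ cancel (end1 n -1ℤ) (end1 n 1ℤ) ⟩
  end1 n 1ℤ                                  ∎
  where
  open ≡-Reasoning
  cancel : ∀ a b → (a + b) - a ≡ b
  cancel = solve-∀

monotone-from-suc : (f : ℕ → ℤ) → (∀ n → f n ℤ.≤ f (suc n)) → ∀ {m n} → m ≤ n → f m ℤ.≤ f n
monotone-from-suc f step m≤n = go (≤⇒≤′ m≤n)
  where
  go : ∀ {m n} → m ≤′ n → f m ℤ.≤ f n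
  go ≤′-refl        = ≤-refl
  go (≤′-step m≤′n) = ≤-trans (go m≤′n) (step _)

end1-≤-suc : ∀ s n → end1 n s ℤ.≤ end1 (suc n) s
end1-≤-suc s n = begin
  end1 n s                      ≡⟨ sym (+-identityʳ (end1 n s)) ⟩
  end1 n s + 0ℤ                 ≤⟨ +-monoʳ-≤ (end1 n s) (sumSeqs-nonneg n (𝟙-nonneg ∘ _)) ⟩
  end1 n s + start1end1 n s     ≡⟨ sym (end1-suc n s) ⟩
  end1 (suc n) s                ∎
  where open ℤ.≤-Reasoning

end1-mono : ∀ s {m n} → m ≤ n → end1 m s ℤ.≤ end1 n s
end1-mono s = monotone-from-suc (λ n → end1 n s) (end1-≤-suc s)

mainTheorem4 : ((n : ℕ) → 3 ≤ n → + 0 < D n)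
                 × ((n : ℕ) → 2 ≤ n → + 0 < D (Data.Nat.suc n) - D n)
mainTheorem4 = D-pos , D-increasing
  where
  open ℤ.≤-Reasoning
  D-pos : (n : ℕ) → 3 ≤ n → + 0 < D n
  D-pos n 3≤n = begin-strict
    0ℤ             <⟨ +<+ (s≤s z≤n) ⟩
    end1 3 -1ℤ     ≤⟨ end1-mono -1ℤ 3≤n ⟩
    end1 n -1ℤ     ≡⟨ sym (D≡end1 n) ⟩
    D n            ∎
  D-increasing : (n : ℕ) → 2 ≤ n → + 0 < D (suc n) - D n
  D-increasing n 2≤n = begin-strict
    0ℤ             <⟨ +<+ (s≤s z≤n) ⟩
    end1 2 1ℤ      ≤⟨ end1-mono 1ℤ 2≤n ⟩
    end1 n 1ℤ      ≡⟨ sym (D-suc-minus-D n) ⟩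
    D (suc n) - D n ∎
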